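{- Let $\mathcal R$ be a set of rules and $\mathrm{ar}$ an arity function such that for every rule $\ell\Rightarrow r\in\mathcal R$ both $\ell$ and $r$ respect $\mathrm{ar}$. Then $\to_{\mathcal R}$ is terminating if and only if every arity-respecting term is terminating under $\to_{\mathcal R}$.
   Context: Sorts $\mathcal S$; simple types are sorts and $\sigma\to\tau$ (right-associative). Pairwise disjoint sets $\mathcal F$ (function symbols), $\mathcal V$ (variables), each typed and containing infinitely many symbols of every type, and $\mathcal M$ (meta-variables), each with a declaration $[\sigma_1\times\dots\times\sigma_k]\to\tau$ ($k=\mathrm{ar}(Z)$). Meta-terms: variables, function symbols, typed application $s\,t$ (left-associative), abstraction $\lambda x.s$, and $Z\langle s_1,\dots,s_e\rangle:\tau$ for $Z:[\sigma_1\times\dots\times\sigma_k]\to\sigma_{k+1}\to\dots\to\sigma_e\to\tau$ with $s_i:\sigma_i$; modulo $\alpha$. Terms contain no meta-variables. Patterns: $Z\langle x_1,\dots,x_k\rangle$ (distinct variables, $k=\mathrm{ar}(Z)$), $\lambda x.\ell$, $a\,\ell_1\cdots\ell_n$ with $a\in\mathcal F\cup\mathcal V$. A substitution $\gamma$ maps variables to terms and $Z$ (arity $k$) to $\lambda y_1\dots y_k.u$; $\gamma(Z)\approx_e\lambda x_1\dots x_e.s$ iff $\gamma(Z)=\lambda x_1\dots x_e.s$ or $\gamma(Z)=\lambda x_1\dots x_i.t$ with $k\le i<e$, $t$ not an abstraction, $s=t\,x_{i+1}\cdots x_e$; $Z\langle s_1,\dots,s_e\rangle\gamma=t[x_1:=s_1\gamma,\dots,x_e:=s_e\gamma]$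 for $\gamma(Z)\approx_e\lambda x_1\dots x_e.t$, and otherwise substitution acts structurally and capture-avoidingly. A rule $\ell\Rightarrow r$ is a pair of closed meta-terms of the same type, $\ell$ a pattern $f\,\ell_1\cdots\ell_n$ with $f\in\mathcal F$, every meta-variable of $r$ occurring in $\ell$. $\to_{\mathcal R}$ is the smallest relation on terms closed under all contexts (also below $\lambda$) containing $\ell\delta\to r\delta$ ($\ell\Rightarrow r\in\mathcal R$, $\delta$ a substitution on the meta-variables of $\ell$) and $(\lambda x.s)t\to s[x:=t]$. A term is terminating if there is no infinite $\to_{\mathcal R}$-reduction from it; $\to_{\mathcal R}$ is terminating if every term is. An arity function is $\mathrm{ar}:\mathcal F\to\mathbb N$ with $\mathrm{ar}(f)\le m$ for $f:\sigma_1\to\dots\to\sigma_m\to\iota$; a (meta-)term respects $\mathrm{ar}$ if every occurrence of every $f$ in it is applied to at least $\mathrm{ar}(f)$ arguments. -}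

module Defs where

open import Data.Nat using (ℕ; zero; suc; _≤_)
open import Data.List using (List; []; _∷_; _++_)
open import Data.List.Relation.Unary.All using (All; []; _∷_; toList)
open import Data.List.Relation.Unary.Unique.Propositional using (Unique)
open import Data.Product using (Σ; _×_; _,_; proj₁; proj₂)
open import Data.Unit using (⊤)
open import Relation.Nullary using (¬_)
open import Relation.Binary.PropositionalEquality using (_≡_)

data Ty (S : Set) : Set where
  sort : S → Ty S
  _⇒_  : Ty S → Ty S → Ty S

infixr 20 _⇒_

data _∋_ {A : Set} : List A → A → Set where
  here  : ∀ {Γ a} → (a ∷ Γ) ∋ a
  there : ∀ {Γ a b} → Γ ∋ b → (a ∷ Γ) ∋ b

Ctx : Set → Set
Ctx S = List (Ty S)

-- meta-variable declaration [σ₁ × … × σₖ] → τ  is the pair (σ₁ … σₖ , τ)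
MDecl : Set → Set
MDecl S = List (Ty S) × Ty S

MCtx : Set → Set
MCtx S = List (MDecl S)

nargs : ∀ {S} → Ty S → ℕ
nargs (sort _) = zero
nargs (σ ⇒ τ)  = suc (nargs τ)

module _ {S : Set} (F : Ty S → Set) where

  -- Terms (no meta-variables); variables are de Bruijn indices
  -- (terms are taken modulo α)

  data Tm (Γ : Ctx S) : Ty S → Set where
    var : ∀ {τ} → Γ ∋ τ → Tm Γ τ
    fun : ∀ {τ} → F τ → Tm Γ τ
    app : ∀ {σ τ} → Tm Γ (σ ⇒ τ) → Tm Γ σ → Tm Γ τ
    lam : ∀ {σ τ} → Tm (σ ∷ Γ) τ → Tm Γ (σ ⇒ τ)

  Ren : Ctx S → Ctx S → Set
  Ren Γ Γ' = ∀ {τ} → Γ ∋ τ → Γ' ∋ τ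

  liftR : ∀ {Γ Γ' σ} → Ren Γ Γ' → Ren (σ ∷ Γ) (σ ∷ Γ')
  liftR r here      = here
  liftR r (there x) = there (r x)

  ren : ∀ {Γ Γ' τ} → Ren Γ Γ' → Tm Γ τ → Tm Γ' τ
  ren r (var x)   = var (r x)
  ren r (fun f)   = fun f
  ren r (app s t) = app (ren r s) (ren r t)
  ren r (lam s)   = lam (ren (liftR r) s)

  Sub : Ctx S → Ctx S → Set
  Sub Γ Γ' = ∀ {τ} → Γ ∋ τ → Tm Γ' τ

  liftS : ∀ {Γ Γ' σ} → Sub Γ Γ' → Sub (σ ∷ Γ) (σ ∷ Γ')
  liftS θ here      = var here
  liftS θ (there x) = ren there (θ x)

  sub : ∀ {Γ Γ' τ} → Sub Γ Γ' → Tm Γ τ → Tm Γ' τ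
  sub θ (var x)   = θ x
  sub θ (fun f)   = fun f
  sub θ (app s t) = app (sub θ s) (sub θ t)
  sub θ (lam s)   = lam (sub (liftS θ) s)

  single : ∀ {Γ σ} → Tm Γ σ → Sub (σ ∷ Γ) Γ
  single t here      = t
  single t (there x) = var x

  _[_] : ∀ {Γ σ τ} → Tm (σ ∷ Γ) τ → Tm Γ σ → Tm Γ τ
  s [ t ] = sub (single t) s

  envSub : ∀ {Γ Ξ} → All (Tm Γ) Ξ → Sub (Ξ ++ Γ) Γ
  envSub []       x         = var x
  envSub (t ∷ ts) here      = t
  envSub (t ∷ ts) (there x) = envSub ts x

  emptySub : ∀ {Γ} → Sub [] Γ
  emptySub ()

  data TSpine (Γ : Ctx S) : Ty S → Ty S → Set where
    []  : ∀ {τ} → TSpine Γ τ τ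
    _∷_ : ∀ {σ ρ τ} → Tm Γ σ → TSpine Γ ρ τ → TSpine Γ (σ ⇒ ρ) τ

  apps : ∀ {Γ ρ τ} → Tm Γ ρ → TSpine Γ ρ τ → Tm Γ τ
  apps u []       = u
  apps u (t ∷ ts) = apps (app u t) ts

  -- γ(Z) = λ y₁ … yₖ . u   (exactly k displayed abstractions, u arbitrary)
  data Lams : Ctx S → List (Ty S) → Ty S → Set where
    body : ∀ {Γ ρ} → Tm Γ ρ → Lams Γ [] ρ
    blam : ∀ {Γ σ σs ρ} → Lams (σ ∷ Γ) σs ρ → Lams Γ (σ ∷ σs) ρ

  renL : ∀ {Γ Γ' σs ρ} → Ren Γ Γ' → Lams Γ σs ρ → Lams Γ' σs ρ
  renL r (body u) = body (ren r u)
  renL r (blam L) = blam (renL (liftR r) L)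

  -- further syntactic abstractions of γ(Z) are consumed while extra
  -- arguments remain (the ≈ₑ clause); then the accumulated arguments are
  -- substituted simultaneously and the remaining ones are applied
  peel : ∀ {Γ Ξ ρ τ} → Tm (Ξ ++ Γ) ρ → All (Tm Γ) Ξ → TSpine Γ ρ τ → Tm Γ τ
  peel (lam b) env (t ∷ ts) = peel b (t ∷ env) ts
  peel u       env ts       = apps (sub (envSub env) u) ts

  instL : ∀ {Γ Ξ σs ρ τ} → Lams (Ξ ++ Γ) σs ρ → All (Tm Γ) Ξ →
          All (Tm Γ) σs → TSpine Γ ρ τ → Tm Γ τ
  instL (body u) env []       ts = peel u env ts
  instL (blam L) env (s ∷ ss) ts = instL L (s ∷ env) ss ts

  data MTm (Δ : MCtx S) (Γ : Ctx S) : Ty S → Set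
  data MArgs (Δ : MCtx S) (Γ : Ctx S) : List (Ty S) → Set
  data MSpine (Δ : MCtx S) (Γ : Ctx S) : Ty S → Ty S → Set

  data MTm Δ Γ where
    mvar : ∀ {τ} → Γ ∋ τ → MTm Δ Γ τ
    mfun : ∀ {τ} → F τ → MTm Δ Γ τ
    mapp : ∀ {σ τ} → MTm Δ Γ (σ ⇒ τ) → MTm Δ Γ σ → MTm Δ Γ τ
    mlam : ∀ {σ τ} → MTm Δ (σ ∷ Γ) τ → MTm Δ Γ (σ ⇒ τ)
    -- Z⟨s₁,…,sₖ,sₖ₊₁,…,sₑ⟩ : the first k arguments, then the spine
    mv   : ∀ {d τ} → Δ ∋ d → MArgs Δ Γ (proj₁ d) → MSpine Δ Γ (proj₂ d) τ →
           MTm Δ Γ τ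

  data MArgs Δ Γ where
    []  : MArgs Δ Γ []
    _∷_ : ∀ {σ σs} → MTm Δ Γ σ → MArgs Δ Γ σs → MArgs Δ Γ (σ ∷ σs)

  data MSpine Δ Γ where
    []  : ∀ {τ} → MSpine Δ Γ τ τ
    _∷_ : ∀ {σ ρ τ} → MTm Δ Γ σ → MSpine Δ Γ ρ τ → MSpine Δ Γ (σ ⇒ ρ) τ

  MSub : MCtx S → Ctx S → Set
  MSub Δ Γ = ∀ {d} → Δ ∋ d → Lams Γ (proj₁ d) (proj₂ d)

  weakM : ∀ {Δ Γ σ} → MSub Δ Γ → MSub Δ (σ ∷ Γ)
  weakM δ Z = renL there (δ Z)

  inst   : ∀ {Δ Ψ Γ τ} → MSub Δ Γ → Sub Ψ Γ → MTm Δ Ψ τ → Tm Γ τ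
  instA  : ∀ {Δ Ψ Γ σs} → MSub Δ Γ → Sub Ψ Γ → MArgs Δ Ψ σs → All (Tm Γ) σs
  instSp : ∀ {Δ Ψ Γ ρ τ} → MSub Δ Γ → Sub Ψ Γ → MSpine Δ Ψ ρ τ → TSpine Γ ρ τ

  inst δ θ (mvar x)     = θ x
  inst δ θ (mfun f)     = fun f
  inst δ θ (mapp s t)   = app (inst δ θ s) (inst δ θ t)
  inst δ θ (mlam s)     = lam (inst (weakM δ) (liftS θ) s)
  inst δ θ (mv Z ss sp) = instL (δ Z) [] (instA δ θ ss) (instSp δ θ sp)

  instA δ θ []       = []
  instA δ θ (s ∷ ss) = inst δ θ s ∷ instA δ θ ss

  instSp δ θ []       = []
  instSp δ θ (s ∷ sp) = inst δ θ s ∷ instSp δ θ sp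

  data Occ {Δ d} (Z : Δ ∋ d) : ∀ {Γ τ} → MTm Δ Γ τ → Set
  data OccA {Δ d} (Z : Δ ∋ d) : ∀ {Γ σs} → MArgs Δ Γ σs → Set
  data OccS {Δ d} (Z : Δ ∋ d) : ∀ {Γ ρ τ} → MSpine Δ Γ ρ τ → Set

  data Occ {Δ} {d} Z where
    at     : ∀ {Γ τ} {ss : MArgs Δ Γ (proj₁ d)} {sp : MSpine Δ Γ (proj₂ d) τ} →
             Occ Z (mv Z ss sp)
    inArgs : ∀ {Γ τ d'} {Z' : Δ ∋ d'} {ss : MArgs Δ Γ (proj₁ d')}
               {sp : MSpine Δ Γ (proj₂ d') τ} → OccA Z ss → Occ Z (mv Z' ss sp)
    inSp   : ∀ {Γ τ d'} {Z' : Δ ∋ d'} {ss : MArgs Δ Γ (proj₁ d')}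
               {sp : MSpine Δ Γ (proj₂ d') τ} → OccS Z sp → Occ Z (mv Z' ss sp)
    appˡ   : ∀ {Γ σ τ} {s : MTm Δ Γ (σ ⇒ τ)} {t : MTm Δ Γ σ} → Occ Z s → Occ Z (mapp s t)
    appʳ   : ∀ {Γ σ τ} {s : MTm Δ Γ (σ ⇒ τ)} {t : MTm Δ Γ σ} → Occ Z t → Occ Z (mapp s t)
    lamO   : ∀ {Γ σ τ} {s : MTm Δ (σ ∷ Γ) τ} → Occ Z s → Occ Z (mlam s)

  data OccA {Δ} {d} Z where
    hd : ∀ {Γ σ σs} {s : MTm Δ Γ σ} {ss : MArgs Δ Γ σs} → Occ Z s → OccA Z (s ∷ ss)
    tl : ∀ {Γ σ σs} {s : MTm Δ Γ σ} {ss : MArgs Δ Γ σs} → OccA Z ss → OccA Z (s ∷ ss)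

  data OccS {Δ} {d} Z where
    hd : ∀ {Γ σ ρ τ} {s : MTm Δ Γ σ} {sp : MSpine Δ Γ ρ τ} → Occ Z s → OccS Z (s ∷ sp)
    tl : ∀ {Γ σ ρ τ} {s : MTm Δ Γ σ} {sp : MSpine Δ Γ ρ τ} → OccS Z sp → OccS Z (s ∷ sp)

  varArgs : ∀ {Δ Γ σs} → All (Γ ∋_) σs → MArgs Δ Γ σs
  varArgs []       = []
  varArgs (x ∷ xs) = mvar x ∷ varArgs xs

  data IsPat {Δ} : ∀ {Γ τ} → MTm Δ Γ τ → Set
  data IsAppPat {Δ} : ∀ {Γ τ} → MTm Δ Γ τ → Set

  data IsPat {Δ} where
    pmv  : ∀ {Γ d} (Z : Δ ∋ d) (xs : All (Γ ∋_) (proj₁ d)) → Unique (toList xs) →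
           IsPat (mv Z (varArgs xs) [])
    plam : ∀ {Γ σ τ} {s : MTm Δ (σ ∷ Γ) τ} → IsPat s → IsPat (mlam s)
    papp : ∀ {Γ τ} {s : MTm Δ Γ τ} → IsAppPat s → IsPat s

  data IsAppPat {Δ} where
    hfun : ∀ {Γ τ} (f : F τ) → IsAppPat {Γ = Γ} (mfun f)
    hvar : ∀ {Γ τ} (x : Γ ∋ τ) → IsAppPat (mvar x)
    happ : ∀ {Γ σ τ} {s : MTm Δ Γ (σ ⇒ τ)} {t : MTm Δ Γ σ} →
           IsAppPat s → IsPat t → IsAppPat (mapp s t)

  data IsRuleLhs {Δ} : ∀ {Γ τ} → MTm Δ Γ τ → Set where
    lfun : ∀ {Γ τ} (f : F τ) → IsRuleLhs {Γ = Γ} (mfun f)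
    lapp : ∀ {Γ σ τ} {s : MTm Δ Γ (σ ⇒ τ)} {t : MTm Δ Γ σ} →
           IsRuleLhs s → IsPat t → IsRuleLhs (mapp s t)

  record Rule : Set where
    field
      Δ     : MCtx S
      τ     : Ty S
      lhs   : MTm Δ [] τ
      rhs   : MTm Δ [] τ
      lhs-pattern : IsRuleLhs lhs
      rhs-mvars   : ∀ {d} (Z : Δ ∋ d) → Occ Z rhs → Occ Z lhs

  module _ (R : Rule → Set) where

    data _⟶_ : ∀ {Γ τ} → Tm Γ τ → Tm Γ τ → Set where
      rule : ∀ {Γ} (ρ : Rule) → R ρ → (δ : MSub (Rule.Δ ρ) Γ) →
             inst δ emptySub (Rule.lhs ρ) ⟶ inst δ emptySub (Rule.rhs ρ)
      beta : ∀ {Γ σ τ} (s : Tm (σ ∷ Γ) τ) (t : Tm Γ σ) → app (lam s) t ⟶ (s [ t ])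
      appˡ : ∀ {Γ σ τ} {s s' : Tm Γ (σ ⇒ τ)} {t : Tm Γ σ} → s ⟶ s' → app s t ⟶ app s' t
      appʳ : ∀ {Γ σ τ} {s : Tm Γ (σ ⇒ τ)} {t t' : Tm Γ σ} → t ⟶ t' → app s t ⟶ app s t'
      lamc : ∀ {Γ σ τ} {s s' : Tm (σ ∷ Γ) τ} → s ⟶ s' → lam s ⟶ lam s'

    TerminatingTm : ∀ {Γ τ} → Tm Γ τ → Set
    TerminatingTm {Γ} {τ} t =
      ¬ (Σ (ℕ → Tm Γ τ) λ f → f zero ≡ t × (∀ i → f i ⟶ f (suc i)))

    Terminating : Set
    Terminating = ∀ {Γ τ} (t : Tm Γ τ) → TerminatingTm t

  IsArityFn : (∀ {σ} → F σ → ℕ) → Set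
  IsArityFn ar = ∀ {σ} (f : F σ) → ar f ≤ nargs σ

  module _ (ar : ∀ {σ} → F σ → ℕ) where

    -- RespN t n : every occurrence of f in t respects ar, given that t
    -- itself is applied to n further arguments
    RespN : ∀ {Γ τ} → Tm Γ τ → ℕ → Set
    RespN (var x)   n = ⊤
    RespN (fun f)   n = ar f ≤ n
    RespN (app s t) n = RespN s (suc n) × RespN t zero
    RespN (lam s)   n = RespN s zero

    Respects : ∀ {Γ τ} → Tm Γ τ → Set
    Respects t = RespN t zero

    MRespN  : ∀ {Δ Γ τ} → MTm Δ Γ τ → ℕ → Set
    MRespA  : ∀ {Δ Γ σs} → MArgs Δ Γ σs → Set
    MRespSp : ∀ {Δ Γ ρ τ} → MSpine Δ Γ ρ τ → Set

    MRespN (mvar x)     n = ⊤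
    MRespN (mfun f)     n = ar f ≤ n
    MRespN (mapp s t)   n = MRespN s (suc n) × MRespN t zero
    MRespN (mlam s)     n = MRespN s zero
    MRespN (mv Z ss sp) n = MRespA ss × MRespSp sp

    MRespA []       = ⊤
    MRespA (s ∷ ss) = MRespN s zero × MRespA ss

    MRespSp []       = ⊤
    MRespSp (s ∷ sp) = MRespN s zero × MRespSp sp

    MRespects : ∀ {Δ Γ τ} → MTm Δ Γ τ → Set
    MRespects s = MRespN s zero

    RuleRespects : Rule → Set
    RuleRespects ρ = MRespects (Rule.lhs ρ) × MRespects (Rule.rhs ρ)

-- Only the backward direction needs an argument. Saturate a term by η-expanding every occurrence
-- of a symbol f applied to i < ar f arguments (ar f ∸ i) times. The saturation respects ar, and
-- expansion is a simulation: a β-step of s is matched by the same β-step in u, and a rule step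
-- ℓδ → rδ by β-steps turning u into ℓδ', δ' the saturation of δ, followed by the rule step to rδ',
-- which again expands rδ because r respects ar. As every step of s is matched by at least one step
-- of u, an infinite reduction from a term yields one from its saturation.
module Submission where

open import Defs
open import Data.Nat using (ℕ; zero; suc; _+_; _∸_; _≤_; _<_; z≤n; s≤s; _≤?_)
open import Data.Nat.Properties
  using (≤-trans; <-trans; <⇒≤; <⇒≱; ≰⇒>; n<1+n; m≤m+n; m≤n⇒m<n∨m≡n; +-suc; +-identityʳ; n∸n≡0;
         m≤n⇒m∸n≡0; +-∸-assoc; ∸-+-assoc; m≤n+o⇒m∸n≤o; m≤n+m∸n)
open import Data.List using (List; []; _∷_; _++_)
open import Data.List.Relation.Unary.All using (All; []; _∷_)
open import Data.Product using (Σ; _×_; _,_; proj₁; proj₂)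
open import Data.Sum using (inj₁; inj₂)
open import Data.Unit using (⊤; tt)
open import Data.Empty using (⊥-elim)
open import Function.Base using (_∘_)
open import Function.Bundles using (_⇔_; _↣_; mk⇔)
open import Relation.Nullary using (yes; no)
open import Relation.Binary.PropositionalEquality using (_≡_; refl; sym; trans; cong; cong₂; subst; subst₂)
open import Relation.Binary.Construct.Closure.ReflexiveTransitive using (Star; ε; _◅_; _◅◅_; gmap)
open import Relation.Binary.Construct.Closure.Transitive using (TransClosure; _∷_) renaming ([_] to [_]⁺)

InfiniteChain : {A : Set} → (A → A → Set) → A → Set
InfiniteChain {A} _∼_ x = Σ (ℕ → A) λ f → f zero ≡ x × (∀ i → f i ∼ f (suc i))

module _ {A : Set} where

  module _ {_∼_ : A → A → Set} where

    infiniteChain⁺⇒infiniteChain : ∀ {x} → InfiniteChain (TransClosure _∼_) x → InfiniteChain _∼_ x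
    infiniteChain⁺⇒infiniteChain (g , g₀ , g⁺) = current ∘ walk , g₀ , λ n → step (walk n)
      where
      Position : Set
      Position = Σ ℕ λ i → Σ A λ z → TransClosure _∼_ z (g (suc i))

      current : Position → A
      current (_ , z , _) = z

      next : Position → Position
      next (i , _ , [ _ ]⁺)             = suc i , g (suc i) , g⁺ (suc i)
      next (i , _ , _∷_ {y = y} _ rest) = i , y , rest

      step : ∀ p → current p ∼ current (next p)
      step (_ , _ , [ z∼ ]⁺) = z∼
      step (_ , _ , z∼ ∷ _)  = z∼

      walk : ℕ → Position
      walk zero    = 0 , g 0 , g⁺ 0
      walk (suc n) = next (walk n)

  module _ {B : Set} {_∼_ : A → A → Set} {_≈_ : B → B → Set} (_≲_ : A → B → Set)
           (simulate : ∀ {u s t} → s ≈ t → u ≲ s → Σ A λ u' → TransClosure _∼_ u u' × u' ≲ t) where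

    simulation-preserves-infiniteChain : ∀ {u s} → u ≲ s → InfiniteChain _≈_ s → InfiniteChain _∼_ u
    simulation-preserves-infiniteChain {u} u≲s (g , refl , g≈) =
      infiniteChain⁺⇒infiniteChain (proj₁ ∘ follow , refl , follow⁺)
      where
      follow : ∀ i → Σ A (_≲ g i)
      follow zero    = u , u≲s
      follow (suc i) = let u' , _ , u'≲ = simulate (g≈ i) (proj₂ (follow i)) in u' , u'≲

      follow⁺ : ∀ i → TransClosure _∼_ (proj₁ (follow i)) (proj₁ (follow (suc i)))
      follow⁺ i = proj₁ (proj₂ (simulate (g≈ i) (proj₂ (follow i))))

module Substitution {S : Set} (F : Ty S → Set) where

  ren-cong : ∀ {Γ Γ' τ} {r r' : Ren F Γ Γ'} → (∀ {σ} (x : Γ ∋ σ) → r x ≡ r' x) →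
             (s : Tm F Γ τ) → ren F r s ≡ ren F r' s
  ren-cong h (var x)   = cong var (h x)
  ren-cong h (fun f)   = refl
  ren-cong h (app s t) = cong₂ app (ren-cong h s) (ren-cong h t)
  ren-cong {r = r} {r'} h (lam s) = cong lam (ren-cong lift-h s)
    where
    lift-h : ∀ {σ} x → liftR F r {σ} x ≡ liftR F r' x
    lift-h here      = refl
    lift-h (there x) = cong there (h x)

  ren-id : ∀ {Γ τ} (s : Tm F Γ τ) → ren F (λ x → x) s ≡ s
  ren-id (var x)   = refl
  ren-id (fun f)   = refl
  ren-id (app s t) = cong₂ app (ren-id s) (ren-id t)
  ren-id (lam s)   = cong lam (trans (ren-cong lift-id s) (ren-id s))
    where
    lift-id : ∀ {ρ} x → liftR F (λ y → y) {ρ} x ≡ x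
    lift-id here      = refl
    lift-id (there x) = refl

  ren-∘ : ∀ {Γ Γ' Γ'' τ} (r' : Ren F Γ' Γ'') (r : Ren F Γ Γ') (s : Tm F Γ τ) →
          ren F r' (ren F r s) ≡ ren F (λ x → r' (r x)) s
  ren-∘ r' r (var x)   = refl
  ren-∘ r' r (fun f)   = refl
  ren-∘ r' r (app s t) = cong₂ app (ren-∘ r' r s) (ren-∘ r' r t)
  ren-∘ r' r (lam s)   = cong lam (trans (ren-∘ (liftR F r') (liftR F r) s) (ren-cong lift-∘ s))
    where
    lift-∘ : ∀ {σ} x → liftR F r' {σ} (liftR F r x) ≡ liftR F (λ y → r' (r y)) x
    lift-∘ here      = refl
    lift-∘ (there x) = refl

  sub-cong : ∀ {Γ Γ' τ} {θ θ' : Sub F Γ Γ'} → (∀ {ρ} (x : Γ ∋ ρ) → θ x ≡ θ' x) →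
             (s : Tm F Γ τ) → sub F θ s ≡ sub F θ' s
  sub-cong h (var x)   = h x
  sub-cong h (fun f)   = refl
  sub-cong h (app s t) = cong₂ app (sub-cong h s) (sub-cong h t)
  sub-cong {θ = θ} {θ'} h (lam s) = cong lam (sub-cong lift-h s)
    where
    lift-h : ∀ {ρ} x → liftS F θ {ρ} x ≡ liftS F θ' x
    lift-h here      = refl
    lift-h (there x) = cong (ren F there) (h x)

  ren-sub : ∀ {Γ Γ' Γ'' τ} (r : Ren F Γ' Γ'') (θ : Sub F Γ Γ') (s : Tm F Γ τ) →
            ren F r (sub F θ s) ≡ sub F (λ x → ren F r (θ x)) s
  ren-sub r θ (var x)   = refl
  ren-sub r θ (fun f)   = refl
  ren-sub r θ (app s t) = cong₂ app (ren-sub r θ s) (ren-sub r θ t)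
  ren-sub r θ (lam s)   = cong lam (trans (ren-sub (liftR F r) (liftS F θ) s) (sub-cong lift-h s))
    where
    lift-h : ∀ {ρ} x → ren F (liftR F r) (liftS F θ {ρ} x) ≡ liftS F (λ y → ren F r (θ y)) x
    lift-h here      = refl
    lift-h (there x) = trans (ren-∘ (liftR F r) there (θ x)) (sym (ren-∘ there r (θ x)))

  sub-ren : ∀ {Γ Γ' Γ'' τ} (θ : Sub F Γ' Γ'') (r : Ren F Γ Γ') (s : Tm F Γ τ) →
            sub F θ (ren F r s) ≡ sub F (λ x → θ (r x)) s
  sub-ren θ r (var x)   = refl
  sub-ren θ r (fun f)   = refl
  sub-ren θ r (app s t) = cong₂ app (sub-ren θ r s) (sub-ren θ r t)
  sub-ren θ r (lam s)   = cong lam (trans (sub-ren (liftS F θ) (liftR F r) s) (sub-cong lift-h s))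
    where
    lift-h : ∀ {ρ} x → liftS F θ {ρ} (liftR F r x) ≡ liftS F (λ y → θ (r y)) x
    lift-h here      = refl
    lift-h (there x) = refl

  sub-var≡ren : ∀ {Γ Γ' τ} (r : Ren F Γ Γ') (s : Tm F Γ τ) → sub F (λ x → var (r x)) s ≡ ren F r s
  sub-var≡ren r (var x)   = refl
  sub-var≡ren r (fun f)   = refl
  sub-var≡ren r (app s t) = cong₂ app (sub-var≡ren r s) (sub-var≡ren r t)
  sub-var≡ren r (lam s)   = cong lam (trans (sub-cong lift-h s) (sub-var≡ren (liftR F r) s))
    where
    lift-h : ∀ {ρ} x → liftS F (λ y → var (r y)) {ρ} x ≡ var (liftR F r x)
    lift-h here      = refl
    lift-h (there x) = refl

  sub-id : ∀ {Γ τ} (s : Tm F Γ τ) → sub F var s ≡ s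
  sub-id s = trans (sub-var≡ren (λ x → x) s) (ren-id s)

  single-weaken : ∀ {Γ σ τ} (t : Tm F Γ σ) (s : Tm F Γ τ) → sub F (single F t) (ren F there s) ≡ s
  single-weaken t s = trans (sub-ren (single F t) there s) (sub-id s)

  liftS-weaken : ∀ {Γ Γ' σ τ} (θ : Sub F Γ Γ') (s : Tm F Γ τ) →
                 sub F (liftS F {σ = σ} θ) (ren F there s) ≡ ren F there (sub F θ s)
  liftS-weaken θ s = trans (sub-ren (liftS F θ) there s) (sym (ren-sub there θ s))

  liftR-weaken : ∀ {Γ Γ' σ τ} (r : Ren F Γ Γ') (s : Tm F Γ τ) →
                 ren F (liftR F {σ = σ} r) (ren F there s) ≡ ren F there (ren F r s)
  liftR-weaken r s = trans (ren-∘ (liftR F r) there s) (sym (ren-∘ there r s))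

  ren-sub-single : ∀ {Γ Γ' σ τ} (r : Ren F Γ Γ') (s : Tm F (σ ∷ Γ) τ) (t : Tm F Γ σ) →
           ren F r (sub F (single F t) s) ≡ sub F (single F (ren F r t)) (ren F (liftR F r) s)
  ren-sub-single r s t = trans (ren-sub r (single F t) s)
                   (trans (sub-cong single-h s) (sym (sub-ren (single F (ren F r t)) (liftR F r) s)))
    where
    single-h : ∀ {ρ} x → ren F r (single F t {ρ} x) ≡ single F (ren F r t) (liftR F r x)
    single-h here      = refl
    single-h (there x) = refl

  length : ∀ {Γ ρ τ} → TSpine F Γ ρ τ → ℕ
  length []       = zero
  length (t ∷ ts) = suc (length ts)

  renSpine : ∀ {Γ Γ' ρ τ} → Ren F Γ Γ' → TSpine F Γ ρ τ → TSpine F Γ' ρ τ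
  renSpine r []       = []
  renSpine r (t ∷ ts) = ren F r t ∷ renSpine r ts

  subSpine : ∀ {Γ Γ' ρ τ} → Sub F Γ Γ' → TSpine F Γ ρ τ → TSpine F Γ' ρ τ
  subSpine θ []       = []
  subSpine θ (t ∷ ts) = sub F θ t ∷ subSpine θ ts

  renEnv : ∀ {Γ Γ' Ξ} → Ren F Γ Γ' → All (Tm F Γ) Ξ → All (Tm F Γ') Ξ
  renEnv r []       = []
  renEnv r (t ∷ ts) = ren F r t ∷ renEnv r ts

  length-subSpine : ∀ {Γ Γ' ρ τ} (θ : Sub F Γ Γ') (A : TSpine F Γ ρ τ) →
                    length (subSpine θ A) ≡ length A
  length-subSpine θ []      = refl
  length-subSpine θ (t ∷ A) = cong suc (length-subSpine θ A)

  ren-apps : ∀ {Γ Γ' ρ τ} (r : Ren F Γ Γ') (u : Tm F Γ ρ) (A : TSpine F Γ ρ τ) →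
             ren F r (apps F u A) ≡ apps F (ren F r u) (renSpine r A)
  ren-apps r u []      = refl
  ren-apps r u (t ∷ A) = ren-apps r (app u t) A

  sub-apps : ∀ {Γ Γ' ρ τ} (θ : Sub F Γ Γ') (u : Tm F Γ ρ) (A : TSpine F Γ ρ τ) →
             sub F θ (apps F u A) ≡ apps F (sub F θ u) (subSpine θ A)
  sub-apps θ u []      = refl
  sub-apps θ u (t ∷ A) = sub-apps θ (app u t) A

  liftRs : ∀ {Γ Γ'} (Ξ : List (Ty S)) → Ren F Γ Γ' → Ren F (Ξ ++ Γ) (Ξ ++ Γ')
  liftRs []      r = r
  liftRs (σ ∷ Ξ) r = liftR F (liftRs Ξ r)

  ren-envSub : ∀ {Γ Γ' Ξ τ} (r : Ren F Γ Γ') (env : All (Tm F Γ) Ξ) (x : (Ξ ++ Γ) ∋ τ) →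
               ren F r (envSub F env x) ≡ envSub F (renEnv r env) (liftRs Ξ r x)
  ren-envSub r []        x         = refl
  ren-envSub r (t ∷ env) here      = refl
  ren-envSub r (t ∷ env) (there x) = ren-envSub r env x

  ren-sub-envSub : ∀ {Γ Γ' Ξ τ} (r : Ren F Γ Γ') (env : All (Tm F Γ) Ξ) (u : Tm F (Ξ ++ Γ) τ) →
                   ren F r (sub F (envSub F env) u) ≡
                   sub F (envSub F (renEnv r env)) (ren F (liftRs Ξ r) u)
  ren-sub-envSub {Ξ = Ξ} r env u =
    trans (ren-sub r (envSub F env) u)
      (trans (sub-cong (ren-envSub r env) u) (sym (sub-ren (envSub F (renEnv r env)) (liftRs Ξ r) u)))

  ren-apps-sub-envSub : ∀ {Γ Γ' Ξ ρ τ} (r : Ren F Γ Γ') (u : Tm F (Ξ ++ Γ) ρ) (env : All (Tm F Γ) Ξ)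
                        (ts : TSpine F Γ ρ τ) →
                        ren F r (apps F (sub F (envSub F env) u) ts) ≡
                        apps F (sub F (envSub F (renEnv r env)) (ren F (liftRs Ξ r) u)) (renSpine r ts)
  ren-apps-sub-envSub r u env ts =
    trans (ren-apps r _ ts) (cong (λ z → apps F z (renSpine r ts)) (ren-sub-envSub r env u))

  ren-peel : ∀ {Γ Γ' Ξ ρ τ} (r : Ren F Γ Γ') (u : Tm F (Ξ ++ Γ) ρ) (env : All (Tm F Γ) Ξ)
             (ts : TSpine F Γ ρ τ) →
             ren F r (peel F u env ts) ≡ peel F (ren F (liftRs Ξ r) u) (renEnv r env) (renSpine r ts)
  ren-peel r (lam b)   env (t ∷ ts) = ren-peel r b (t ∷ env) ts
  ren-peel r (lam b)   env []       = ren-apps-sub-envSub r (lam b) env []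
  ren-peel r (var x)   env ts       = ren-apps-sub-envSub r (var x) env ts
  ren-peel r (fun f)   env ts       = ren-apps r _ ts
  ren-peel r (app s t) env ts       = ren-apps-sub-envSub r (app s t) env ts

  ren-instL : ∀ {Γ Γ' Ξ σs ρ τ} (r : Ren F Γ Γ') (L : Lams F (Ξ ++ Γ) σs ρ) (env : All (Tm F Γ) Ξ)
              (ss : All (Tm F Γ) σs) (ts : TSpine F Γ ρ τ) →
              ren F r (instL F L env ss ts) ≡
              instL F (renL F (liftRs Ξ r) L) (renEnv r env) (renEnv r ss) (renSpine r ts)
  ren-instL r (body u) env []       ts = ren-peel r u env ts
  ren-instL r (blam L) env (s ∷ ss) ts = ren-instL r L (s ∷ env) ss ts

  renL-cong : ∀ {Γ Γ' σs ρ} {r r' : Ren F Γ Γ'} → (∀ {σ} (x : Γ ∋ σ) → r x ≡ r' x) →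
              (L : Lams F Γ σs ρ) → renL F r L ≡ renL F r' L
  renL-cong h (body u) = cong body (ren-cong h u)
  renL-cong {r = r} {r'} h (blam L) = cong blam (renL-cong lift-h L)
    where
    lift-h : ∀ {σ} x → liftR F r {σ} x ≡ liftR F r' x
    lift-h here      = refl
    lift-h (there x) = cong there (h x)

  renL-∘ : ∀ {Γ Γ' Γ'' σs ρ} (r' : Ren F Γ' Γ'') (r : Ren F Γ Γ') (L : Lams F Γ σs ρ) →
           renL F r' (renL F r L) ≡ renL F (λ x → r' (r x)) L
  renL-∘ r' r (body u) = cong body (ren-∘ r' r u)
  renL-∘ r' r (blam L) = cong blam (trans (renL-∘ (liftR F r') (liftR F r) L) (renL-cong lift-∘ L))
    where
    lift-∘ : ∀ {σ} x → liftR F r' {σ} (liftR F r x) ≡ liftR F (λ y → r' (r y)) x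
    lift-∘ here      = refl
    lift-∘ (there x) = refl

  RenInst : ∀ {Δ Ψ Γ Γ'} → Ren F Γ Γ' → MSub F Δ Γ → Sub F Ψ Γ → MSub F Δ Γ' → Sub F Ψ Γ' → Set
  RenInst {Δ} {Ψ} r δ θ δ' θ' =
    (∀ {d} (Z : Δ ∋ d) → renL F r (δ Z) ≡ δ' Z) × (∀ {σ} (x : Ψ ∋ σ) → ren F r (θ x) ≡ θ' x)

  liftRenInst : ∀ {Δ Ψ Γ Γ' σ} {r : Ren F Γ Γ'} {δ : MSub F Δ Γ} {θ : Sub F Ψ Γ}
                {δ' : MSub F Δ Γ'} {θ' : Sub F Ψ Γ'} → RenInst r δ θ δ' θ' →
                RenInst (liftR F {σ = σ} r) (weakM F δ) (liftS F θ) (weakM F δ') (liftS F θ')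
  liftRenInst {r = r} {δ} {θ} {δ'} {θ'} (hδ , hθ) = hδ' , hθ'
    where
    hδ' : ∀ {d} Z → renL F (liftR F r) (weakM F δ {d} Z) ≡ weakM F δ' Z
    hδ' Z = trans (renL-∘ (liftR F r) there (δ Z))
              (trans (sym (renL-∘ there r (δ Z))) (cong (renL F there) (hδ Z)))
    hθ' : ∀ {ρ} x → ren F (liftR F r) (liftS F θ {ρ} x) ≡ liftS F θ' x
    hθ' here      = refl
    hθ' (there x) = trans (liftR-weaken r (θ x)) (cong (ren F there) (hθ x))

  mutual
    ren-inst : ∀ {Δ Ψ Γ Γ' τ} {r : Ren F Γ Γ'} {δ : MSub F Δ Γ} {θ : Sub F Ψ Γ}
               {δ' : MSub F Δ Γ'} {θ' : Sub F Ψ Γ'} → RenInst r δ θ δ' θ' →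
               (M : MTm F Δ Ψ τ) → ren F r (inst F δ θ M) ≡ inst F δ' θ' M
    ren-inst h (mvar x)   = proj₂ h x
    ren-inst h (mfun f)   = refl
    ren-inst h (mapp M N) = cong₂ app (ren-inst h M) (ren-inst h N)
    ren-inst h (mlam M)   = cong lam (ren-inst (liftRenInst h) M)
    ren-inst {r = r} {δ} {θ} {δ'} h (mv Z ss sp) =
      trans (ren-instL r (δ Z) [] _ _)
        (trans (cong (λ L → instL F L [] (renEnv r (instA F δ θ ss)) (renSpine r (instSp F δ θ sp)))
                     (proj₁ h Z))
               (cong₂ (instL F (δ' Z) []) (ren-instArgs h ss) (ren-instSpine h sp)))

    ren-instArgs : ∀ {Δ Ψ Γ Γ' σs} {r : Ren F Γ Γ'} {δ : MSub F Δ Γ} {θ : Sub F Ψ Γ}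
                   {δ' : MSub F Δ Γ'} {θ' : Sub F Ψ Γ'} → RenInst r δ θ δ' θ' →
                   (ss : MArgs F Δ Ψ σs) → renEnv r (instA F δ θ ss) ≡ instA F δ' θ' ss
    ren-instArgs h []       = refl
    ren-instArgs h (s ∷ ss) = cong₂ _∷_ (ren-inst h s) (ren-instArgs h ss)

    ren-instSpine : ∀ {Δ Ψ Γ Γ' ρ τ} {r : Ren F Γ Γ'} {δ : MSub F Δ Γ} {θ : Sub F Ψ Γ}
                    {δ' : MSub F Δ Γ'} {θ' : Sub F Ψ Γ'} → RenInst r δ θ δ' θ' →
                    (sp : MSpine F Δ Ψ ρ τ) → renSpine r (instSp F δ θ sp) ≡ instSp F δ' θ' sp
    ren-instSpine h []       = refl
    ren-instSpine h (s ∷ sp) = cong₂ _∷_ (ren-inst h s) (ren-instSpine h sp)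

  η-expand : ∀ {Γ τ} → ℕ → Tm F Γ τ → Tm F Γ τ
  η-expand zero                 X = X
  η-expand {τ = sort _} (suc j) X = X
  η-expand {τ = σ ⇒ τ}  (suc j) X = lam (η-expand j (app (ren F there X) (var here)))

  ren-η-expand : ∀ {Γ Γ' τ} (r : Ren F Γ Γ') (j : ℕ) (X : Tm F Γ τ) →
                 ren F r (η-expand j X) ≡ η-expand j (ren F r X)
  ren-η-expand r zero X = refl
  ren-η-expand {τ = sort _} r (suc j) X = refl
  ren-η-expand {τ = σ ⇒ τ}  r (suc j) X =
    cong lam (trans (ren-η-expand (liftR F r) j (app (ren F there X) (var here)))
                    (cong (λ z → η-expand j (app z (var here))) (liftR-weaken r X)))

  sub-η-expand : ∀ {Γ Γ' τ} (θ : Sub F Γ Γ') (j : ℕ) (X : Tm F Γ τ) →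
                 sub F θ (η-expand j X) ≡ η-expand j (sub F θ X)
  sub-η-expand θ zero X = refl
  sub-η-expand {τ = sort _} θ (suc j) X = refl
  sub-η-expand {τ = σ ⇒ τ}  θ (suc j) X =
    cong lam (trans (sub-η-expand (liftS F θ) j (app (ren F there X) (var here)))
                    (cong (λ z → η-expand j (app z (var here))) (liftS-weaken θ X)))

module Reduction {S : Set} (F : Ty S → Set) (R : Rule F → Set) where
  open Substitution F

  infix 4 _↝_ _↝*_ _↝⁺_

  _↝_ : ∀ {Γ τ} → Tm F Γ τ → Tm F Γ τ → Set
  _↝_ = _⟶_ F R

  _↝*_ : ∀ {Γ τ} → Tm F Γ τ → Tm F Γ τ → Set
  _↝*_ = Star _↝_

  _↝⁺_ : ∀ {Γ τ} → Tm F Γ τ → Tm F Γ τ → Set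
  _↝⁺_ = TransClosure _↝_

  ↝*-snoc⁺ : ∀ {Γ τ} {a b c : Tm F Γ τ} → a ↝* b → b ↝ c → a ↝⁺ c
  ↝*-snoc⁺ ε        b↝c = [ b↝c ]⁺
  ↝*-snoc⁺ (a↝ ◅ p) b↝c = a↝ ∷ ↝*-snoc⁺ p b↝c

  map⁺ : ∀ {Γ Γ' τ τ'} (g : Tm F Γ τ → Tm F Γ' τ') → (∀ {a b} → a ↝ b → g a ↝ g b) →
         ∀ {a b} → a ↝⁺ b → g a ↝⁺ g b
  map⁺ g h [ a↝b ]⁺ = [ h a↝b ]⁺
  map⁺ g h (a↝ ∷ p)  = h a↝ ∷ map⁺ g h p

  appsˡ-↝ : ∀ {Γ ρ τ} {u u' : Tm F Γ ρ} (B : TSpine F Γ ρ τ) → u ↝ u' → apps F u B ↝ apps F u' B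
  appsˡ-↝ []      u↝ = u↝
  appsˡ-↝ (b ∷ B) u↝ = appsˡ-↝ B (appˡ u↝)

  appsˡ-↝* : ∀ {Γ ρ τ} {u u' : Tm F Γ ρ} (B : TSpine F Γ ρ τ) → u ↝* u' → apps F u B ↝* apps F u' B
  appsˡ-↝* B = gmap (λ z → apps F z B) (appsˡ-↝ B)

  apps-arg-↝* : ∀ {Γ σ ρ τ} (u : Tm F Γ (σ ⇒ ρ)) {w w' : Tm F Γ σ} (B : TSpine F Γ ρ τ) →
                w ↝* w' → apps F u (w ∷ B) ↝* apps F u (w' ∷ B)
  apps-arg-↝* u B = gmap (λ z → apps F (app u z) B) (λ w↝ → appsˡ-↝ B (appʳ w↝))

  lam-↝* : ∀ {Γ σ τ} {u u' : Tm F (σ ∷ Γ) τ} → u ↝* u' → lam u ↝* lam u'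
  lam-↝* = gmap lam lamc

  ren-↝ : ∀ {Γ Γ' τ} (r : Ren F Γ Γ') {s t : Tm F Γ τ} → s ↝ t → ren F r s ↝ ren F r t
  ren-↝ r (rule ρ Rρ δ) =
    subst₂ _↝_ (sym (ren-inst hr (Rule.lhs ρ))) (sym (ren-inst hr (Rule.rhs ρ))) (rule ρ Rρ δr)
    where
    δr : MSub F (Rule.Δ ρ) _
    δr Z = renL F r (δ Z)
    hr : RenInst r δ (emptySub F) δr (emptySub F)
    hr = (λ Z → refl) , λ ()
  ren-↝ r (beta s t) =
    subst (app (lam (ren F (liftR F r) s)) (ren F r t) ↝_) (sym (ren-sub-single r s t)) (beta _ _)
  ren-↝ r (appˡ s↝) = appˡ (ren-↝ r s↝)
  ren-↝ r (appʳ t↝) = appʳ (ren-↝ r t↝)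
  ren-↝ r (lamc s↝) = lamc (ren-↝ (liftR F r) s↝)

  η-expand-↝ : ∀ {Γ τ} (j : ℕ) {X X' : Tm F Γ τ} → X ↝ X' → η-expand j X ↝ η-expand j X'
  η-expand-↝ zero X↝ = X↝
  η-expand-↝ {τ = sort _} (suc j) X↝ = X↝
  η-expand-↝ {τ = σ ⇒ τ}  (suc j) X↝ = lamc (η-expand-↝ j (appˡ (ren-↝ there X↝)))

  η-expand-↝* : ∀ {Γ τ} (j : ℕ) {X X' : Tm F Γ τ} → X ↝* X' → η-expand j X ↝* η-expand j X'
  η-expand-↝* j = gmap (η-expand j) (η-expand-↝ j)

  η-expand-↝⁺ : ∀ {Γ τ} (j : ℕ) {X X' : Tm F Γ τ} → X ↝⁺ X' → η-expand j X ↝⁺ η-expand j X'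
  η-expand-↝⁺ j = map⁺ (η-expand j) (η-expand-↝ j)

  apps-η-expand-↝* : ∀ {Γ ρ τ} (j : ℕ) (X : Tm F Γ ρ) (B : TSpine F Γ ρ τ) →
                     apps F (η-expand j X) B ↝* η-expand (j ∸ length B) (apps F X B)
  apps-η-expand-↝* j       X []      = ε
  apps-η-expand-↝* zero    X (b ∷ B) = ε
  apps-η-expand-↝* (suc j) X (b ∷ B) =
    appsˡ-↝ B (beta _ b) ◅
    subst (λ z → apps F z B ↝* η-expand (j ∸ length B) (apps F (app X b) B)) (sym contractum)
          (apps-η-expand-↝* j (app X b) B)
    where
    contractum : sub F (single F b) (η-expand j (app (ren F there X) (var here))) ≡ η-expand j (app X b)
    contractum = trans (sub-η-expand (single F b) j _)
                       (cong (λ z → η-expand j (app z b)) (single-weaken b X))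

module Expansion {S : Set} (F : Ty S → Set) (ar : ∀ {σ} → F σ → ℕ) where
  open Substitution F

  -- Expands n u s: u is s with every occurrence of a symbol f that has only i < ar f
  -- arguments η-expanded (ar f ∸ i) times, where s itself is applied to n further arguments.
  mutual
    data Expands {Γ} : ℕ → ∀ {τ} → Tm F Γ τ → Tm F Γ τ → Set where
      evar : ∀ {n τ} (x : Γ ∋ τ) → Expands n (var x) (var x)
      efun : ∀ {n τ} (f : F τ) → ar f ≤ n → Expands n (fun f) (fun f)
      eapp : ∀ {n σ τ} {u₁ s₁ : Tm F Γ (σ ⇒ τ)} {u₂ s₂ : Tm F Γ σ} →
             Expands (suc n) u₁ s₁ → Expands 0 u₂ s₂ → Expands n (app u₁ u₂) (app s₁ s₂)
      elam : ∀ {n σ τ} {u s : Tm F (σ ∷ Γ) τ} → Expands 0 u s → Expands n (lam u) (lam s)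
      eη   : ∀ {n ρ τ i} {f : F ρ} {u s : Tm F Γ τ} → HeadExpands f u s i → i < ar f →
             Expands n (η-expand (ar f ∸ i) u) s

    data HeadExpands {Γ} {ρ} (f : F ρ) : ∀ {τ} → Tm F Γ τ → Tm F Γ τ → ℕ → Set where
      hd  : HeadExpands f (fun f) (fun f) 0
      arg : ∀ {σ τ i} {u s : Tm F Γ (σ ⇒ τ)} {w t : Tm F Γ σ} →
            HeadExpands f u s i → Expands 0 w t → HeadExpands f (app u w) (app s t) (suc i)

  data ExpandsSpine {Γ} : ∀ {ρ τ} → TSpine F Γ ρ τ → TSpine F Γ ρ τ → Set where
    []  : ∀ {τ} → ExpandsSpine {ρ = τ} {τ} [] []
    _∷_ : ∀ {σ ρ τ} {a a' : Tm F Γ σ} {A A' : TSpine F Γ ρ τ} →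
          Expands 0 a' a → ExpandsSpine A' A → ExpandsSpine (a' ∷ A') (a ∷ A)

  data ExpandsEnv {Γ} : ∀ {Ξ} → All (Tm F Γ) Ξ → All (Tm F Γ) Ξ → Set where
    []  : ExpandsEnv [] []
    _∷_ : ∀ {σ Ξ} {a a' : Tm F Γ σ} {A A' : All (Tm F Γ) Ξ} →
          Expands 0 a' a → ExpandsEnv A' A → ExpandsEnv (a' ∷ A') (a ∷ A)

  data ExpandsLams : ∀ {Γ σs ρ} → Lams F Γ σs ρ → Lams F Γ σs ρ → Set where
    body : ∀ {Γ ρ} {u u' : Tm F Γ ρ} → Expands 0 u' u → ExpandsLams (body u') (body u)
    blam : ∀ {Γ σ σs ρ} {L L' : Lams F (σ ∷ Γ) σs ρ} → ExpandsLams L' L → ExpandsLams (blam L') (blam L)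

  ExpandsSub : ∀ {Γ Γ'} → Sub F Γ Γ' → Sub F Γ Γ' → Set
  ExpandsSub {Γ} θ' θ = ∀ {τ} (x : Γ ∋ τ) → Expands 0 (θ' x) (θ x)

  ExpandsMSub : ∀ {Δ Γ} → MSub F Δ Γ → MSub F Δ Γ → Set
  ExpandsMSub {Δ} δ' δ = ∀ {d} (Z : Δ ∋ d) → ExpandsLams (δ' Z) (δ Z)

  length-expandsSpine : ∀ {Γ ρ τ} {A' A : TSpine F Γ ρ τ} → ExpandsSpine A' A → length A' ≡ length A
  length-expandsSpine []      = refl
  length-expandsSpine (_ ∷ e) = cong suc (length-expandsSpine e)

  expands-mono : ∀ {Γ n m τ} {u s : Tm F Γ τ} → Expands n u s → n ≤ m → Expands m u s
  expands-mono (evar x)    n≤m = evar x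
  expands-mono (efun f ≤n) n≤m = efun f (≤-trans ≤n n≤m)
  expands-mono (eapp e e₂) n≤m = eapp (expands-mono e (s≤s n≤m)) e₂
  expands-mono (elam e)    n≤m = elam e
  expands-mono (eη h i<)   n≤m = eη h i<

  expands-mono₀ : ∀ {Γ m τ} {u s : Tm F Γ τ} → Expands 0 u s → Expands m u s
  expands-mono₀ e = expands-mono e z≤n

  mutual
    expands-ren : ∀ {Γ Γ' n τ} (r : Ren F Γ Γ') {u s : Tm F Γ τ} →
                  Expands n u s → Expands n (ren F r u) (ren F r s)
    expands-ren r (evar x)     = evar (r x)
    expands-ren r (efun f ≤n)  = efun f ≤n
    expands-ren r (eapp e₁ e₂) = eapp (expands-ren r e₁) (expands-ren r e₂)
    expands-ren r (elam e)     = elam (expands-ren (liftR F r) e)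
    expands-ren r (eη {i = i} {f = f} {u = u} h i<) =
      subst (λ z → Expands _ z _) (sym (ren-η-expand r (ar f ∸ i) u)) (eη (headExpands-ren r h) i<)

    headExpands-ren : ∀ {Γ Γ' ρ τ i} (r : Ren F Γ Γ') {f : F ρ} {u s : Tm F Γ τ} →
                      HeadExpands f u s i → HeadExpands f (ren F r u) (ren F r s) i
    headExpands-ren r hd        = hd
    headExpands-ren r (arg h e) = arg (headExpands-ren r h) (expands-ren r e)

  expandsSub-lift : ∀ {Γ Γ' ρ} {θ' θ : Sub F Γ Γ'} → ExpandsSub θ' θ →
                    ExpandsSub (liftS F {σ = ρ} θ') (liftS F θ)
  expandsSub-lift h here      = evar here
  expandsSub-lift h (there x) = expands-ren there (h x)

  mutual
    expands-sub : ∀ {Γ Γ' n τ} {θ' θ : Sub F Γ Γ'} → ExpandsSub θ' θ → {u s : Tm F Γ τ} →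
                  Expands n u s → Expands n (sub F θ' u) (sub F θ s)
    expands-sub h (evar x)     = expands-mono₀ (h x)
    expands-sub h (efun f ≤n)  = efun f ≤n
    expands-sub h (eapp e₁ e₂) = eapp (expands-sub h e₁) (expands-sub h e₂)
    expands-sub h (elam e)     = elam (expands-sub (expandsSub-lift h) e)
    expands-sub {θ' = θ'} h (eη {i = i} {f = f} {u = u} hu i<) =
      subst (λ z → Expands _ z _) (sym (sub-η-expand θ' (ar f ∸ i) u)) (eη (headExpands-sub h hu) i<)

    headExpands-sub : ∀ {Γ Γ' ρ τ i} {θ' θ : Sub F Γ Γ'} → ExpandsSub θ' θ → {f : F ρ} {u s : Tm F Γ τ} →
                      HeadExpands f u s i → HeadExpands f (sub F θ' u) (sub F θ s) i
    headExpands-sub h hd         = hd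
    headExpands-sub h (arg hu e) = arg (headExpands-sub h hu) (expands-sub h e)

  single-expands : ∀ {Γ σ} {u t : Tm F Γ σ} → Expands 0 u t → ExpandsSub (single F u) (single F t)
  single-expands e here      = e
  single-expands e (there x) = evar x

  expands-apps : ∀ {Γ n ρ τ} {u s : Tm F Γ ρ} {A' A : TSpine F Γ ρ τ} →
                 Expands (length A + n) u s → ExpandsSpine A' A → Expands n (apps F u A') (apps F s A)
  expands-apps e []       = e
  expands-apps e (a ∷ eA) = expands-apps (eapp e a) eA

  headExpands-apps : ∀ {Γ ρ σ τ i} {f : F ρ} {u s : Tm F Γ σ} {A' A : TSpine F Γ σ τ} →
                     HeadExpands f u s i → ExpandsSpine A' A →
                     HeadExpands f (apps F u A') (apps F s A) (length A + i)
  headExpands-apps h [] = h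
  headExpands-apps {i = i} h (_∷_ {A = A} a eA) =
    subst (HeadExpands _ _ _) (+-suc (length A) i) (headExpands-apps (arg h a) eA)

  headExpands-saturated : ∀ {Γ ρ τ i n} {f : F ρ} {u s : Tm F Γ τ} →
                          HeadExpands f u s i → ar f ≤ i + n → Expands n u s
  headExpands-saturated hd ≤n = efun _ ≤n
  headExpands-saturated {i = suc i} {n} {f = f} (arg h e) ≤n =
    eapp (headExpands-saturated h (subst (ar f ≤_) (sym (+-suc i n)) ≤n)) e

  -- saturate s A is the arity-respecting form of apps s A, the spine A being saturated already
  saturate : ∀ {Γ ρ τ} → Tm F Γ ρ → TSpine F Γ ρ τ → Tm F Γ τ
  saturate (var x)   A = apps F (var x) A
  saturate (fun f)   A = η-expand (ar f ∸ length A) (apps F (fun f) A)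
  saturate (app s t) A = saturate s (saturate t [] ∷ A)
  saturate (lam s)   A = apps F (lam (saturate s [])) A

  saturateLams : ∀ {Γ σs ρ} → Lams F Γ σs ρ → Lams F Γ σs ρ
  saturateLams (body u) = body (saturate u [])
  saturateLams (blam L) = blam (saturateLams L)

  saturate-expands : ∀ {Γ ρ τ} (s : Tm F Γ ρ) {A' A : TSpine F Γ ρ τ} → ExpandsSpine A' A →
                     Expands 0 (saturate s A') (apps F s A)
  saturate-expands (var x) eA = expands-apps (evar x) eA
  saturate-expands (fun f) {A'} {A} eA rewrite length-expandsSpine eA with ar f ≤? length A
  ... | yes ≤A = subst (λ j → Expands 0 (η-expand j (apps F (fun f) A')) (apps F (fun f) A))
                       (sym (m≤n⇒m∸n≡0 ≤A))
                       (expands-apps (efun f (subst (ar f ≤_) (sym (+-identityʳ _)) ≤A)) eA)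
  ... | no ≰A  = subst (λ i → Expands 0 (η-expand (ar f ∸ i) (apps F (fun f) A')) (apps F (fun f) A))
                       (+-identityʳ (length A))
                       (eη (headExpands-apps hd eA) (subst (_< ar f) (sym (+-identityʳ _)) (≰⇒> ≰A)))
  saturate-expands (app s t) eA = saturate-expands s (saturate-expands t [] ∷ eA)
  saturate-expands (lam s)   eA = expands-apps (elam (saturate-expands s [])) eA

  saturateLams-expands : ∀ {Γ σs ρ} (L : Lams F Γ σs ρ) → ExpandsLams (saturateLams L) L
  saturateLams-expands (body u) = body (saturate-expands u [])
  saturateLams-expands (blam L) = blam (saturateLams-expands L)

  envSub-expands : ∀ {Γ Ξ} {env' env : All (Tm F Γ) Ξ} → ExpandsEnv env' env →
                   ExpandsSub (envSub F {Γ} {Ξ} env') (envSub F env)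
  envSub-expands []       x         = evar x
  envSub-expands (e ∷ _)  here      = e
  envSub-expands (_ ∷ eE) (there x) = envSub-expands eE x

  peel-[] : ∀ {Γ Ξ ρ} (u : Tm F (Ξ ++ Γ) ρ) (env : All (Tm F Γ) Ξ) → peel F u env [] ≡ sub F (envSub F env) u
  peel-[] (var x)   env = refl
  peel-[] (fun f)   env = refl
  peel-[] (app u t) env = refl
  peel-[] (lam u)   env = refl

  peel-headExpandsˡ : ∀ {Γ Ξ ρ σ τ i} {f : F ρ} {u s : Tm F (Ξ ++ Γ) σ} → HeadExpands f u s i →
                      (env : All (Tm F Γ) Ξ) (sp : TSpine F Γ σ τ) →
                      peel F u env sp ≡ apps F (sub F (envSub F env) u) sp
  peel-headExpandsˡ hd        env sp = refl
  peel-headExpandsˡ (arg h e) env sp = refl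

  peel-headExpandsʳ : ∀ {Γ Ξ ρ σ τ i} {f : F ρ} {u s : Tm F (Ξ ++ Γ) σ} → HeadExpands f u s i →
                      (env : All (Tm F Γ) Ξ) (sp : TSpine F Γ σ τ) →
                      peel F s env sp ≡ apps F (sub F (envSub F env) s) sp
  peel-headExpandsʳ hd        env sp = refl
  peel-headExpandsʳ (arg h e) env sp = refl

  ∸-suc : ∀ m n → n < m → m ∸ n ≡ suc (m ∸ suc n)
  ∸-suc m n n<m = +-∸-assoc 1 n<m

  -- the abstractions added by η-expansion are consumed by peel like those of γ(Z) itself
  peel-η-expand : ∀ {Γ Ξ n ρ σ τ i} {f : F ρ} {u s : Tm F (Ξ ++ Γ) σ} → HeadExpands f u s i → i ≤ ar f →
                  {env' env : All (Tm F Γ) Ξ} → ExpandsEnv env' env →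
                  {sp' sp : TSpine F Γ σ τ} → ExpandsSpine sp' sp →
                  Expands n (peel F (η-expand (ar f ∸ i) u) env' sp') (apps F (sub F (envSub F env) s) sp)
  peel-η-expand h i≤ eEnv eSp with m≤n⇒m<n∨m≡n i≤
  peel-η-expand {f = f} h _ {env'} eEnv {sp'} eSp | inj₂ refl
    rewrite n∸n≡0 (ar f) | peel-headExpandsˡ h env' sp' =
    expands-apps (expands-sub (envSub-expands eEnv) (headExpands-saturated h (m≤m+n (ar f) _))) eSp
  peel-η-expand {i = i} {f = f} {u} h _ {env'} eEnv [] | inj₁ i<
    rewrite peel-[] (η-expand (ar f ∸ i) u) env' | sub-η-expand (envSub F env') (ar f ∸ i) u =
    eη (headExpands-sub (envSub-expands eEnv) h) i<
  peel-η-expand {i = i} {f = f} {u} {s} h _ {env'} {env} eEnv (_∷_ {a = t} {A = ts} et eSp) | inj₁ i<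
    rewrite ∸-suc (ar f) i i< =
    subst (λ z → Expands _ _ (apps F (app z t) ts)) (sub-ren (envSub F (t ∷ env)) there s)
      (peel-η-expand (arg (headExpands-ren there h) (evar here)) i< (et ∷ eEnv) eSp)

  peel-expands : ∀ {Γ Ξ n σ τ} {u' u : Tm F (Ξ ++ Γ) σ} → Expands 0 u' u →
                 {env' env : All (Tm F Γ) Ξ} → ExpandsEnv env' env →
                 {sp' sp : TSpine F Γ σ τ} → ExpandsSpine sp' sp →
                 Expands n (peel F u' env' sp') (peel F u env sp)
  peel-expands (evar x)     eEnv eSp = expands-apps (expands-mono₀ (envSub-expands eEnv x)) eSp
  peel-expands (efun f ≤0)  eEnv eSp = expands-apps (efun f (≤-trans ≤0 z≤n)) eSp
  peel-expands (eapp e₁ e₂) eEnv eSp =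
    expands-apps (expands-mono₀ (expands-sub (envSub-expands eEnv) (eapp e₁ e₂))) eSp
  peel-expands (elam e)     eEnv []         = expands-sub (envSub-expands eEnv) (elam e)
  peel-expands (elam e)     eEnv (et ∷ eSp) = peel-expands e (et ∷ eEnv) eSp
  peel-expands (eη h i<) {env = env} eEnv {sp = sp} eSp =
    subst (Expands _ _) (sym (peel-headExpandsʳ h env sp)) (peel-η-expand h (<⇒≤ i<) eEnv eSp)

  instL-expands : ∀ {Γ Ξ n σs ρ τ} {L' L : Lams F (Ξ ++ Γ) σs ρ} → ExpandsLams L' L →
                  {env' env : All (Tm F Γ) Ξ} → ExpandsEnv env' env →
                  {ss' ss : All (Tm F Γ) σs} → ExpandsEnv ss' ss →
                  {sp' sp : TSpine F Γ ρ τ} → ExpandsSpine sp' sp →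
                  Expands n (instL F L' env' ss' sp') (instL F L env ss sp)
  instL-expands (body e)  eEnv []         eSp = peel-expands e eEnv eSp
  instL-expands (blam eL) eEnv (es ∷ eSs) eSp = instL-expands eL (es ∷ eEnv) eSs eSp

  expandsLams-ren : ∀ {Γ Γ' σs ρ} (r : Ren F Γ Γ') {L' L : Lams F Γ σs ρ} →
                    ExpandsLams L' L → ExpandsLams (renL F r L') (renL F r L)
  expandsLams-ren r (body e)  = body (expands-ren r e)
  expandsLams-ren r (blam eL) = blam (expandsLams-ren (liftR F r) eL)

  mutual
    inst-expands : ∀ {Δ Ψ Γ n τ} {δ' δ : MSub F Δ Γ} {θ' θ : Sub F Ψ Γ} (M : MTm F Δ Ψ τ) →
                   MRespN F ar M n → ExpandsMSub δ' δ → ExpandsSub θ' θ →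
                   Expands n (inst F δ' θ' M) (inst F δ θ M)
    inst-expands (mvar x)     _         hδ hθ = expands-mono₀ (hθ x)
    inst-expands (mfun f)     ≤n        hδ hθ = efun f ≤n
    inst-expands (mapp M N)   (rM , rN) hδ hθ = eapp (inst-expands M rM hδ hθ) (inst-expands N rN hδ hθ)
    inst-expands (mlam M)     rM        hδ hθ =
      elam (inst-expands M rM (λ Z → expandsLams-ren there (hδ Z)) (expandsSub-lift hθ))
    inst-expands (mv Z ss sp) (rs , rp) hδ hθ =
      instL-expands (hδ Z) [] (instArgs-expands ss rs hδ hθ) (instSpine-expands sp rp hδ hθ)

    instArgs-expands : ∀ {Δ Ψ Γ σs} {δ' δ : MSub F Δ Γ} {θ' θ : Sub F Ψ Γ} (ss : MArgs F Δ Ψ σs) →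
                       MRespA F ar ss → ExpandsMSub δ' δ → ExpandsSub θ' θ →
                       ExpandsEnv (instA F δ' θ' ss) (instA F δ θ ss)
    instArgs-expands []       _         hδ hθ = []
    instArgs-expands (s ∷ ss) (rs , rss) hδ hθ =
      inst-expands s rs hδ hθ ∷ instArgs-expands ss rss hδ hθ

    instSpine-expands : ∀ {Δ Ψ Γ ρ τ} {δ' δ : MSub F Δ Γ} {θ' θ : Sub F Ψ Γ} (sp : MSpine F Δ Ψ ρ τ) →
                        MRespSp F ar sp → ExpandsMSub δ' δ → ExpandsSub θ' θ →
                        ExpandsSpine (instSp F δ' θ' sp) (instSp F δ θ sp)
    instSpine-expands []       _          hδ hθ = []
    instSpine-expands (s ∷ sp) (rs , rsp) hδ hθ =
      inst-expands s rs hδ hθ ∷ instSpine-expands sp rsp hδ hθ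

  IsRenaming : ∀ {Γ Γ'} → Sub F Γ Γ' → Set
  IsRenaming {Γ} {Γ'} θ = ∀ {τ} (x : Γ ∋ τ) → Σ (Γ' ∋ τ) λ y → θ x ≡ var y

  isRenaming-lift : ∀ {Γ Γ' ρ} {θ : Sub F Γ Γ'} → IsRenaming θ → IsRenaming (liftS F {σ = ρ} θ)
  isRenaming-lift h here = here , refl
  isRenaming-lift h (there x) with h x
  ... | y , θx≡y = there y , cong (ren F there) θx≡y

  -- saturation does not commute with substitution in general, as a substituted term may
  -- receive new arguments; it does commute with renamings
  saturate-sub : ∀ {Γ Γ' ρ τ} {θ : Sub F Γ Γ'} → IsRenaming θ → (s : Tm F Γ ρ) (A : TSpine F Γ ρ τ) →
                 saturate (sub F θ s) (subSpine θ A) ≡ sub F θ (saturate s A)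
  saturate-sub {θ = θ} h (var x) A with h x
  ... | y , θx≡y = trans (cong (λ z → saturate z (subSpine θ A)) θx≡y)
                     (sym (trans (sub-apps θ (var x) A) (cong (λ z → apps F z (subSpine θ A)) θx≡y)))
  saturate-sub {θ = θ} h (fun f) A =
    trans (cong (λ l → η-expand (ar f ∸ l) (apps F (fun f) (subSpine θ A))) (length-subSpine θ A))
      (sym (trans (sub-η-expand θ (ar f ∸ length A) (apps F (fun f) A))
                  (cong (η-expand (ar f ∸ length A)) (sub-apps θ (fun f) A))))
  saturate-sub {θ = θ} h (app s t) A =
    trans (cong (λ z → saturate (sub F θ s) (z ∷ subSpine θ A)) (saturate-sub h t []))
      (saturate-sub h s (saturate t [] ∷ A))
  saturate-sub {θ = θ} h (lam s) A =
    trans (cong (λ z → apps F (lam z) (subSpine θ A)) (saturate-sub (isRenaming-lift h) s []))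
      (sym (sub-apps θ (lam (saturate s [])) A))

  saturate-ren : ∀ {Γ Γ' ρ} (r : Ren F Γ Γ') (u : Tm F Γ ρ) → saturate (ren F r u) [] ≡ ren F r (saturate u [])
  saturate-ren r u = trans (cong (λ z → saturate z []) (sym (sub-var≡ren r u)))
                       (trans (saturate-sub (λ x → r x , refl) u []) (sub-var≡ren r (saturate u [])))

  saturateLams-ren : ∀ {Γ Γ' σs ρ} (r : Ren F Γ Γ') (L : Lams F Γ σs ρ) →
                     saturateLams (renL F r L) ≡ renL F r (saturateLams L)
  saturateLams-ren r (body u) = cong body (saturate-ren r u)
  saturateLams-ren r (blam L) = cong blam (saturateLams-ren (liftR F r) L)

  AllVars : ∀ {Γ Ξ} → All (Tm F Γ) Ξ → Set
  AllVars []                         = ⊤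
  AllVars {Γ} (_∷_ {x = τ} t ts) = Σ (Γ ∋ τ) (λ y → t ≡ var y) × AllVars ts

  envSub-isRenaming : ∀ {Γ Ξ} {env : All (Tm F Γ) Ξ} → AllVars env → IsRenaming (envSub F {Γ} {Ξ} env)
  envSub-isRenaming {env = []}    _       x         = x , refl
  envSub-isRenaming {env = _ ∷ _} (v , _) here      = v
  envSub-isRenaming {env = _ ∷ _} (_ , a) (there x) = envSub-isRenaming a x

  saturate-instL : ∀ {Γ Ξ σs ρ} (L : Lams F (Ξ ++ Γ) σs ρ) (env : All (Tm F Γ) Ξ) (ss : All (Tm F Γ) σs) →
                   AllVars env → AllVars ss →
                   saturate (instL F L env ss []) [] ≡ instL F (saturateLams L) env ss []
  saturate-instL (body u) env [] vEnv _ =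
    trans (cong (λ z → saturate z []) (peel-[] u env))
      (trans (saturate-sub (envSub-isRenaming vEnv) u []) (sym (peel-[] (saturate u []) env)))
  saturate-instL (blam L) env (s ∷ ss) vEnv (v , vSs) = saturate-instL L (s ∷ env) ss (v , vEnv) vSs

  instArgs-varArgs-allVars : ∀ {Δ Ψ Γ σs} (δ : MSub F Δ Γ) {θ : Sub F Ψ Γ} → IsRenaming θ →
                             (xs : All (Ψ ∋_) σs) → AllVars (instA F δ θ (varArgs F xs))
  instArgs-varArgs-allVars δ h []       = tt
  instArgs-varArgs-allVars δ h (x ∷ xs) = h x , instArgs-varArgs-allVars δ h xs

  instArgs-varArgs : ∀ {Δ Ψ Γ σs} (δ δ' : MSub F Δ Γ) (θ : Sub F Ψ Γ) (xs : All (Ψ ∋_) σs) →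
                     instA F δ θ (varArgs F xs) ≡ instA F δ' θ (varArgs F xs)
  instArgs-varArgs δ δ' θ []       = refl
  instArgs-varArgs δ δ' θ (x ∷ xs) = cong (θ x ∷_) (instArgs-varArgs δ δ' θ xs)

  expands-var⁻¹ : ∀ {Γ n τ} {u : Tm F Γ τ} {y : Γ ∋ τ} → Expands n u (var y) → u ≡ var y
  expands-var⁻¹ (evar x) = refl
  expands-var⁻¹ (eη () _)

  respN-mono : ∀ {Γ τ} (u : Tm F Γ τ) {n m} → RespN F ar u n → n ≤ m → RespN F ar u m
  respN-mono (var x)   _         n≤m = tt
  respN-mono (fun f)   ≤n        n≤m = ≤-trans ≤n n≤m
  respN-mono (app s t) (rs , rt) n≤m = respN-mono s rs (s≤s n≤m) , rt
  respN-mono (lam s)   rs        n≤m = rs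

  respN-ren : ∀ {Γ Γ' τ} (r : Ren F Γ Γ') (u : Tm F Γ τ) {n} → RespN F ar u n → RespN F ar (ren F r u) n
  respN-ren r (var x)   _         = tt
  respN-ren r (fun f)   ≤n        = ≤n
  respN-ren r (app s t) (rs , rt) = respN-ren r s rs , respN-ren r t rt
  respN-ren r (lam s)   rs        = respN-ren (liftR F r) s rs

  respN-η-expand : ∀ {Γ τ} (j : ℕ) (X : Tm F Γ τ) {m} → j ≤ nargs τ → RespN F ar X j →
                   RespN F ar (η-expand j X) m
  respN-η-expand zero X _ rX = respN-mono X rX z≤n
  respN-η-expand {τ = σ ⇒ τ} (suc j) X (s≤s j≤) rX =
    respN-η-expand j (app (ren F there X) (var here)) j≤ (respN-ren there X rX , tt)

  headExpands-nargs : ∀ {Γ ρ τ i} {f : F ρ} {u s : Tm F Γ τ} → HeadExpands f u s i → nargs ρ ≡ i + nargs τ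
  headExpands-nargs hd = refl
  headExpands-nargs {τ = τ} {i = suc i} (arg h _) = trans (headExpands-nargs h) (+-suc i (nargs τ))

  module _ (isArityFn : IsArityFn F ar) where

    mutual
      expands⇒respN : ∀ {Γ n τ} {u s : Tm F Γ τ} → Expands n u s → RespN F ar u n
      expands⇒respN (evar x)     = tt
      expands⇒respN (efun f ≤n)  = ≤n
      expands⇒respN (eapp e₁ e₂) = expands⇒respN e₁ , expands⇒respN e₂
      expands⇒respN (elam e)     = expands⇒respN e
      expands⇒respN (eη {i = i} {f = f} {u = u} h _) =
        respN-η-expand (ar f ∸ i) u
          (m≤n+o⇒m∸n≤o (ar f) i (subst (ar f ≤_) (headExpands-nargs h) (isArityFn f)))
          (headExpands⇒respN h (m≤n+m∸n (ar f) i))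

      headExpands⇒respN : ∀ {Γ ρ τ i m} {f : F ρ} {u s : Tm F Γ τ} → HeadExpands f u s i →
                          ar f ≤ i + m → RespN F ar u m
      headExpands⇒respN hd ≤m = ≤m
      headExpands⇒respN {i = suc i} {m} {f = f} (arg h e) ≤m =
        headExpands⇒respN h (subst (ar f ≤_) (sym (+-suc i m)) ≤m) , expands⇒respN e

module Simulation {S : Set} (F : Ty S → Set) (R : Rule F → Set) (ar : ∀ {σ} → F σ → ℕ) where
  open Substitution F
  open Reduction F R
  open Expansion F ar

  mutual
    expands-↝*-saturate : ∀ {Γ n ρ τ} {u s : Tm F Γ ρ} → Expands n u s → (B : TSpine F Γ ρ τ) → n ≤ length B →
                          apps F u B ↝* saturate s B
    expands-↝*-saturate (evar x) B n≤ = ε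
    expands-↝*-saturate (efun f ≤n) B n≤ =
      subst (λ j → apps F (fun f) B ↝* η-expand j (apps F (fun f) B)) (sym (m≤n⇒m∸n≡0 (≤-trans ≤n n≤))) ε
    expands-↝*-saturate (eapp {u₁ = u₁} {s₂ = s₂} e₁ e₂) B n≤ =
      apps-arg-↝* u₁ B (expands-↝*-saturate e₂ [] z≤n) ◅◅
      expands-↝*-saturate e₁ (saturate s₂ [] ∷ B) (s≤s n≤)
    expands-↝*-saturate (elam e) B n≤ = appsˡ-↝* B (lam-↝* (expands-↝*-saturate e [] z≤n))
    expands-↝*-saturate (eη {i = i} {f = f} {u = u} h _) B n≤ with headExpands-↝* h B
    ... | W , u↝* , saturate≡ =
      subst (apps F (η-expand (ar f ∸ i) u) B ↝*_) (sym saturate≡)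
        (subst (λ j → apps F (η-expand (ar f ∸ i) u) B ↝* η-expand j (apps F (fun f) W))
               (∸-+-assoc (ar f) i (length B))
               (apps-η-expand-↝* (ar f ∸ i) u B ◅◅ η-expand-↝* _ u↝*))

    headExpands-↝* : ∀ {Γ ρ σ τ i} {f : F ρ} {u s : Tm F Γ σ} → HeadExpands f u s i → (B : TSpine F Γ σ τ) →
                     Σ (TSpine F Γ ρ τ) λ W → (apps F u B ↝* apps F (fun f) W) ×
                       (saturate s B ≡ η-expand (ar f ∸ (i + length B)) (apps F (fun f) W))
    headExpands-↝* hd B = B , ε , refl
    headExpands-↝* {i = suc i} {f = f} (arg {u = u} {t = t} h e) B
      with headExpands-↝* h (saturate t [] ∷ B)
    ... | W , u↝* , saturate≡ =
      W , apps-arg-↝* u B (expands-↝*-saturate e [] z≤n) ◅◅ u↝* ,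
      trans saturate≡ (cong (λ k → η-expand (ar f ∸ k) (apps F (fun f) W)) (+-suc i (length B)))

  SaturationOf : ∀ {Δ Γ} → MSub F Δ Γ → MSub F Δ Γ → Set
  SaturationOf {Δ} δc δ = ∀ {d} (Z : Δ ∋ d) → δc Z ≡ saturateLams (δ Z)

  saturationOf-weaken : ∀ {Δ Γ σ} {δc δ : MSub F Δ Γ} → SaturationOf δc δ →
                        SaturationOf (weakM F {σ = σ} δc) (weakM F δ)
  saturationOf-weaken {δ = δ} hc Z = trans (cong (renL F there) (hc Z)) (sym (saturateLams-ren there (δ Z)))

  -- β-steps turning an expanded redex back into an instance of the same left-hand side;
  -- θ only renames the variables bound inside that left-hand side
  mutual
    pattern-↝* : ∀ {Δ Ψ Γ τ} {δ δc : MSub F Δ Γ} → SaturationOf δc δ →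
                 {θ : Sub F Ψ Γ} → IsRenaming θ → {p : MTm F Δ Ψ τ} → IsPat F p → MRespN F ar p 0 →
                 {u : Tm F Γ τ} → Expands 0 u (inst F δ θ p) → u ↝* inst F δc θ p
    pattern-↝* {δ = δ} {δc} hc {θ} hθ (pmv Z xs _) _ {u} e =
      subst (u ↝*_) instance≡ (expands-↝*-saturate e [] z≤n)
      where
      instance≡ : saturate (inst F δ θ (mv Z (varArgs F xs) [])) [] ≡
                  inst F δc θ (mv Z (varArgs F xs) [])
      instance≡ = trans (saturate-instL (δ Z) [] _ tt (instArgs-varArgs-allVars δ hθ xs))
                    (cong₂ (λ L ss → instL F L [] ss []) (sym (hc Z)) (instArgs-varArgs δ δc θ xs))
    pattern-↝* hc hθ (plam q) rq (elam e)  =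
      lam-↝* (pattern-↝* (saturationOf-weaken hc) (isRenaming-lift hθ) q rq e)
    pattern-↝* hc hθ (plam q) rq (eη () _)
    pattern-↝* hc hθ (papp a) ra e         = appPattern-↝* hc hθ a ra e [] z≤n

    appPattern-↝* : ∀ {Δ Ψ Γ n m ρ τ} {δ δc : MSub F Δ Γ} → SaturationOf δc δ →
                    {θ : Sub F Ψ Γ} → IsRenaming θ → {p : MTm F Δ Ψ ρ} → IsAppPat F p → MRespN F ar p m →
                    {u : Tm F Γ ρ} → Expands n u (inst F δ θ p) → (B : TSpine F Γ ρ τ) → m ≤ length B →
                    apps F u B ↝* apps F (inst F δc θ p) B
    appPattern-↝* hc hθ (hfun g) _ (efun .g _) B m≤ = ε
    appPattern-↝* hc hθ (hvar x) _ {u} e B m≤ with hθ x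
    ... | y , θx≡y rewrite θx≡y | expands-var⁻¹ e = ε
    appPattern-↝* {δc = δc} hc {θ} hθ (happ {t = q} a qp) (ra , rq) (eapp {u₁ = u₁} e₁ e₂) B m≤ =
      apps-arg-↝* u₁ B (pattern-↝* hc hθ qp rq e₂) ◅◅
      appPattern-↝* hc hθ a ra e₁ (inst F δc θ q ∷ B) (s≤s m≤)
    appPattern-↝* {δc = δc} hc {θ} hθ {p} a ra (eη {i = i} {f = f} {u = u} h _) B m≤
      with headPattern-↝* hc hθ a ra h B m≤
    ... | ≤i+B , u↝* =
      apps-η-expand-↝* (ar f ∸ i) u B ◅◅
      subst (λ j → η-expand j (apps F u B) ↝* apps F (inst F δc θ p) B)
            (sym (trans (∸-+-assoc (ar f) i (length B)) (m≤n⇒m∸n≡0 ≤i+B))) u↝*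

    headPattern-↝* : ∀ {Δ Ψ Γ m i ρ' ρ τ} {f : F ρ'} {δ δc : MSub F Δ Γ} → SaturationOf δc δ →
                     {θ : Sub F Ψ Γ} → IsRenaming θ → {p : MTm F Δ Ψ ρ} → IsAppPat F p → MRespN F ar p m →
                     {u : Tm F Γ ρ} → HeadExpands f u (inst F δ θ p) i → (B : TSpine F Γ ρ τ) → m ≤ length B →
                     (ar f ≤ i + length B) × (apps F u B ↝* apps F (inst F δc θ p) B)
    headPattern-↝* hc hθ (hfun g) ≤m hd B m≤ = ≤-trans ≤m m≤ , ε
    headPattern-↝* hc hθ (hvar x) _ h B m≤ with hθ x
    ... | y , θx≡y rewrite θx≡y with h
    ... | ()
    headPattern-↝* {i = suc i} {f = f} {δc = δc} hc {θ} hθ (happ {t = q} a qp) (ra , rq)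
                   (arg {u = u} h e) B m≤
      with headPattern-↝* hc hθ a ra h (inst F δc θ q ∷ B) (s≤s m≤)
    ... | ≤i+B , u↝* =
      subst (ar f ≤_) (+-suc i (length B)) ≤i+B , apps-arg-↝* u B (pattern-↝* hc hθ qp rq e) ◅◅ u↝*

  ruleLhs⇒appPattern : ∀ {Δ Ψ τ} {ℓ : MTm F Δ Ψ τ} → IsRuleLhs F ℓ → IsAppPat F ℓ
  ruleLhs⇒appPattern (lfun f)   = hfun f
  ruleLhs⇒appPattern (lapp l p) = happ (ruleLhs⇒appPattern l) p

  -- hence no rule step happens at an under-applied head
  appPattern-headExpands-saturated : ∀ {Δ Γ m i ρ' ρ} {f : F ρ'} {δ : MSub F Δ Γ} {p : MTm F Δ [] ρ} →
                                     IsAppPat F p → MRespN F ar p m →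
                                     {u : Tm F Γ ρ} → HeadExpands f u (inst F δ (emptySub F) p) i →
                                     ar f ≤ i + m
  appPattern-headExpands-saturated (hfun g)   ≤m hd = ≤m
  appPattern-headExpands-saturated (hvar ())  _  _
  appPattern-headExpands-saturated {m = m} {i = suc i} {f = f} (happ a _) (ra , _) (arg h _) =
    subst (ar f ≤_) (+-suc i m) (appPattern-headExpands-saturated a ra h)

  module _ (respects : ∀ ρ → R ρ → RuleRespects F ar ρ) where

    mutual
      simulate : ∀ {Γ n τ} {s t u : Tm F Γ τ} → s ↝ t → Expands n u s →
                 Σ (Tm F Γ τ) λ u' → (u ↝⁺ u') × Expands n u' t
      simulate (rule ρ Rρ δ) e =
        inst F δc (emptySub F) (Rule.rhs ρ) ,
        ↝*-snoc⁺ (appPattern-↝* (λ Z → refl) (λ ()) ℓ-pattern rℓ e [] z≤n) (rule ρ Rρ δc) ,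
        expands-mono₀ (inst-expands (Rule.rhs ρ) rr (λ Z → saturateLams-expands (δ Z)) (λ ()))
        where
        ℓ-pattern : IsAppPat F (Rule.lhs ρ)
        ℓ-pattern = ruleLhs⇒appPattern (Rule.lhs-pattern ρ)
        rℓ : MRespects F ar (Rule.lhs ρ)
        rℓ = proj₁ (respects ρ Rρ)
        rr : MRespects F ar (Rule.rhs ρ)
        rr = proj₂ (respects ρ Rρ)
        δc : MSub F (Rule.Δ ρ) _
        δc Z = saturateLams (δ Z)
      simulate (beta s t) (eapp (elam e₁) e₂) =
        _ , [ beta _ _ ]⁺ , expands-sub (single-expands e₂) (expands-mono₀ e₁)
      simulate (beta s t) (eapp (eη () _) _)
      simulate (appˡ s↝) (eapp {u₂ = u₂} e₁ e₂) with simulate s↝ e₁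
      ... | u₁' , u↝⁺ , e₁' = app u₁' u₂ , map⁺ (λ z → app z u₂) appˡ u↝⁺ , eapp e₁' e₂
      simulate (appʳ s↝) (eapp {u₁ = u₁} e₁ e₂) with simulate s↝ e₂
      ... | u₂' , u↝⁺ , e₂' = app u₁ u₂' , map⁺ (app u₁) appʳ u↝⁺ , eapp e₁ e₂'
      simulate (lamc s↝) (elam e) with simulate s↝ e
      ... | u' , u↝⁺ , e' = lam u' , map⁺ lam lamc u↝⁺ , elam e'
      simulate s↝ (eη {i = i} {f = f} h i<) with simulate-head s↝ h i<
      ... | u' , u↝⁺ , h' = η-expand (ar f ∸ i) u' , η-expand-↝⁺ _ u↝⁺ , eη h' i<

      simulate-head : ∀ {Γ ρ τ i} {f : F ρ} {s t u : Tm F Γ τ} → s ↝ t → HeadExpands f u s i → i < ar f →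
                      Σ (Tm F Γ τ) λ u' → (u ↝⁺ u') × HeadExpands f u' t i
      simulate-head {i = i} (rule ρ Rρ δ) h i< =
        ⊥-elim (<⇒≱ i< (subst (_ ≤_) (+-identityʳ i) (appPattern-headExpands-saturated ℓ-pattern rℓ h)))
        where
        ℓ-pattern : IsAppPat F (Rule.lhs ρ)
        ℓ-pattern = ruleLhs⇒appPattern (Rule.lhs-pattern ρ)
        rℓ : MRespects F ar (Rule.lhs ρ)
        rℓ = proj₁ (respects ρ Rρ)
      simulate-head (beta s t) (arg () _) _
      simulate-head (appˡ s↝) (arg {w = w} h e) i< with simulate-head s↝ h (<-trans (n<1+n _) i<)
      ... | u' , u↝⁺ , h' = app u' w , map⁺ (λ z → app z w) appˡ u↝⁺ , arg h' e
      simulate-head (appʳ s↝) (arg {u = u} h e) _ with simulate s↝ e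
      ... | w' , w↝⁺ , e' = app u w' , map⁺ (app u) appʳ w↝⁺ , arg h e'
      simulate-head (lamc s↝) () _

theoremA8 : {S : Set} (F : Ty S → Set) →
              -- infinitely many function symbols of every type
              (∀ σ → ℕ ↣ F σ) →
              (R : Rule F → Set) →
              (ar : ∀ {σ} → F σ → ℕ) → IsArityFn F ar →
              (∀ ρ → R ρ → RuleRespects F ar ρ) →
              (Terminating F R ⇔
                (∀ {Γ τ} (t : Tm F Γ τ) → Respects F ar t → TerminatingTm F R t))
theoremA8 F _ R ar isArityFn respects =
  mk⇔ (λ terminating {_} {_} t _ → terminating t) respecting⇒terminating
  where
  open Expansion F ar
  open Simulation F R ar

  respecting⇒terminating : (∀ {Γ τ} (t : Tm F Γ τ) → Respects F ar t → TerminatingTm F R t) →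
                           Terminating F R
  respecting⇒terminating terminates t chain =
    terminates (saturate t []) (expands⇒respN isArityFn t≲)
      (simulation-preserves-infiniteChain (Expands 0) (simulate respects) t≲ chain)
    where
    t≲ : Expands 0 (saturate t []) t
    t≲ = saturate-expands t []
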